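{- Let $G$ and $G'$ be flow graphs with disjoint vertex sets, and let $\sim$ be the relation on $(V(G)\times\{0\})\cup(V(G')\times\{1\})$ defined below. Then $\sim$ is an equivalence relation.
   Context: All digraphs are finite; loops allowed, no multiple edges. A flow graph is a digraph with exactly one source (vertex with no incoming non-loop edge) and exactly one target (vertex with no outgoing non-loop edge), a unique entry edge out of the source and a unique exit edge into the target (possibly equal or adjacent), and a path cover by source-to-target paths. For an edge $e$, $s(e),t(e)$ are its tail and head. Let $e_s,e_t$ be the entry and exit edges of $G$ and $e'_s,e'_t$ those of $G'$. Fix four distinct points $s(e^+),t(e^+),s(e^-),t(e^-)$ not in $V(G)\cup V(G')$. For a flow graph $G$ define $\phi_G$ on vertices by: $\phi_G(j)=s(e^+)$ if $j=s(e_s)$; otherwise $\phi_G(j)=t(e^+)$ if $j=t(e_s)$, or if $t(e_s)=s(e_t)$ and $j=t(e_t)$; otherwise $\phi_G(j)=s(e^-)$ if $t(e_s)\neq s(e_t)$, $e_s\neq e_t$ and $j=s(e_t)$; otherwise $\phi_G(j)=t(e^-)$ if $t(e_s)\neq s(e_t)$, $e_s\neq e_t$ and $j=t(e_t)$; otherwise $\phi_G(j)=j$. Define $\phi_{G'}$ analogously. Let $\star:=(t(e'_s)\neq s(e'_t))\wedge(e'_s\neq e'_t)$, $\star':=(t(e_s)\neq s(e_t))\wedge(e_s\neq e_t)$, and for $j\in V(G)$, $j'\in V(G')$ let $\star[j]:=\big((t(e_s)=s(e_t))\wedge(j\in\{t(e_s),t(e_t)\})\big)\Rightarrow\star$ and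 $\star[j']:=\big((t(e'_s)=s(e'_t))\wedge(j'\in\{t(e'_s),t(e'_t)\})\big)\Rightarrow\star'$. The relation $\sim$ is: $(j,0)\sim(j,0)$ and $(j',1)\sim(j',1)$ always; for $j\neq k$ in $V(G)$, $(j,0)\sim(k,0)$ iff $\phi_G(j)=\phi_G(k)$ and $\star$; for $j'\neq k'$ in $V(G')$, $(j',1)\sim(k',1)$ iff $\phi_{G'}(j')=\phi_{G'}(k')$ and $\star'$; and $(j,0)\sim(j',1)$ (equivalently $(j',1)\sim(j,0)$) iff $\phi_G(j)=\phi_{G'}(j')$ and $\star[j]$ and $\star[j']$. -}

module Defs where

open import Data.Nat using (ℕ)
open import Data.Fin using (Fin; _≟_)
open import Data.Bool using (Bool; T; true; false; if_then_else_; _∧_; _∨_; not)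
open import Data.Sum using (_⊎_; inj₁; inj₂)
open import Data.Product using (_×_; Σ; ∃; _,_)
open import Data.List using (List; []; _∷_)
open import Data.List.Membership.Propositional using (_∈_)
open import Data.List.Relation.Unary.Unique.Propositional using (Unique)
open import Relation.Nullary using (¬_; ⌊_⌋)
open import Relation.Binary.PropositionalEquality using (_≡_; _≢_)
open import Relation.Binary.Core using (Rel)
open import Level using (0ℓ)

-- A (simple, loops allowed) digraph on the finite vertex set Fin n is an
-- edge predicate E : Fin n → Fin n → Bool (E u v = true iff u → v is an edge).
-- Since there are no multiple edges, an edge is determined by (tail, head).

data Walk {n : ℕ} (E : Fin n → Fin n → Bool) : Fin n → Fin n → List (Fin n) → Set where
  stop : ∀ v → Walk E v v (v ∷ [])
  step : ∀ {u w v vs} → T (E u w) → Walk E w v vs → Walk E u v (u ∷ vs)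

NoIn : {n : ℕ} → (Fin n → Fin n → Bool) → Fin n → Set
NoIn E v = ∀ u → T (E u v) → u ≡ v

NoOut : {n : ℕ} → (Fin n → Fin n → Bool) → Fin n → Set
NoOut E v = ∀ w → T (E v w) → w ≡ v

-- Flow graph.  Entry edge e_s = (src , entryHead), exit edge e_t = (exitTail , tgt).
record FlowGraph : Set where
  field
    n         : ℕ
    E         : Fin n → Fin n → Bool
    src       : Fin n
    tgt       : Fin n
    src-noIn  : NoIn E src
    src-uniq  : ∀ v → NoIn E v → v ≡ src
    tgt-noOut : NoOut E tgt
    tgt-uniq  : ∀ v → NoOut E v → v ≡ tgt
    entryHead : Fin n
    entry-E   : T (E src entryHead)
    entry-uniq : ∀ w → T (E src w) → w ≡ entryHead
    exitTail  : Fin n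
    exit-E    : T (E exitTail tgt)
    exit-uniq : ∀ u → T (E u tgt) → u ≡ exitTail
    cover     : ∀ v → ∃ λ vs → Walk E src tgt vs × Unique vs × v ∈ vs

-- Codomain of φ: vertices of V plus the four fresh points
-- s(e⁺), t(e⁺), s(e⁻), t(e⁻).
data Pt (A : Set) : Set where
  vtx : A → Pt A
  s⁺ t⁺ s⁻ t⁻ : Pt A

mapPt : {A B : Set} → (A → B) → Pt A → Pt B
mapPt f (vtx a) = vtx (f a)
mapPt f s⁺ = s⁺
mapPt f t⁺ = t⁺
mapPt f s⁻ = s⁻
mapPt f t⁻ = t⁻

module _ (G : FlowGraph) where
  open FlowGraph G

  private
    eq : Fin n → Fin n → Bool
    eq a b = ⌊ a ≟ b ⌋

  starB : Bool
  starB = not (eq entryHead exitTail) ∧ not (eq src exitTail ∧ eq entryHead tgt)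

  Star : Set
  Star = (entryHead ≢ exitTail) × ¬ (src ≡ exitTail × entryHead ≡ tgt)

  φ : Fin n → Pt (Fin n)
  φ j =
    if eq j src then s⁺
    else if eq j entryHead ∨ (eq entryHead exitTail ∧ eq j tgt) then t⁺
    else if starB ∧ eq j exitTail then s⁻
    else if starB ∧ eq j tgt then t⁻
    else vtx j

  -- hypothesis part of ⋆[j]:  t(e_s) = s(e_t)  ∧  j ∈ {t(e_s), t(e_t)}
  StarHyp : Fin n → Set
  StarHyp j = (entryHead ≡ exitTail) × (j ≡ entryHead ⊎ j ≡ tgt)

-- The relation ∼ on (V(G) × {0}) ∪ (V(G') × {1}), with the tagged union
-- Fin n ⊎ Fin n' (inj₁ = tag 0, inj₂ = tag 1), which makes the vertex sets disjoint.
Sim : (G G' : FlowGraph) → Rel (Fin (FlowGraph.n G) ⊎ Fin (FlowGraph.n G')) 0ℓ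
Sim G G' (inj₁ j) (inj₁ k) =
  j ≡ k ⊎ (j ≢ k × φ G j ≡ φ G k × Star G')
Sim G G' (inj₂ j') (inj₂ k') =
  j' ≡ k' ⊎ (j' ≢ k' × φ G' j' ≡ φ G' k' × Star G)
Sim G G' (inj₁ j) (inj₂ j') =
  mapPt inj₁ (φ G j) ≡ mapPt inj₂ (φ G' j')
  × (StarHyp G j → Star G') × (StarHyp G' j' → Star G)
Sim G G' (inj₂ j') (inj₁ j) =
  mapPt inj₁ (φ G j) ≡ mapPt inj₂ (φ G' j')
  × (StarHyp G j → Star G') × (StarHyp G' j' → Star G)

-- The only non-injectivity of φ_G is that t(e_s) and t(e_t) may both go to t(e⁺), which
-- happens only when t(e_s) = s(e_t); there the hypothesis of ⋆[j] holds.  Hence if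
-- (j,0) ∼ (j',1) ∼ (k,0) with j ≠ k, then φ_G j = φ_G k and ⋆[j] yields ⋆, i.e. (j,0) ∼ (k,0).
-- On a single side ∼ is the diagonal plus a kernel guarded by a fixed condition, hence
-- transitive, and all mixed cases just compose equalities of φ-values.
module Submission where

open import Defs
open import Data.Fin using (Fin; _≟_)
open import Data.Sum using (_⊎_; inj₁; inj₂; fromInj₁; fromInj₂)
open import Data.Product using (_×_; _,_)
open import Data.Empty using (⊥-elim)
open import Function using (const)
open import Relation.Nullary using (yes; no)
open import Relation.Binary.Core using (Rel)
open import Relation.Binary.Definitions using (DecidableEquality)
open import Relation.Binary.Structures using (IsEquivalence)
open import Relation.Binary.PropositionalEquality

mapPt-retraction : {A B : Set} {f : A → B} {g : B → A} →
                   (∀ x → g (f x) ≡ x) → ∀ p → mapPt g (mapPt f p) ≡ p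
mapPt-retraction gf (vtx x) = cong vtx (gf x)
mapPt-retraction gf s⁺ = refl
mapPt-retraction gf t⁺ = refl
mapPt-retraction gf s⁻ = refl
mapPt-retraction gf t⁻ = refl

mapPt-injective : {A B : Set} {f : A → B} (g : B → A) → (∀ x → g (f x) ≡ x) →
                  ∀ {p q} → mapPt f p ≡ mapPt f q → p ≡ q
mapPt-injective {f = f} g gf {p} {q} fp≡fq = begin
  p                       ≡⟨ mapPt-retraction gf p ⟨
  mapPt g (mapPt f p)     ≡⟨ cong (mapPt g) fp≡fq ⟩
  mapPt g (mapPt f q)     ≡⟨ mapPt-retraction gf q ⟩
  q                       ∎
  where open ≡-Reasoning

Glued : {A B : Set} → (A → B) → Set → Rel A _
Glued f S x y = x ≡ y ⊎ (x ≢ y × f x ≡ f y × S)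

module _ {A B : Set} {f : A → B} {S : Set} where

  glued-intro : DecidableEquality A → ∀ {x y} →
                f x ≡ f y → (x ≢ y → S) → Glued f S x y
  glued-intro _≟ᴬ_ {x} {y} fx≡fy s with x ≟ᴬ y
  ... | yes x≡y = inj₁ x≡y
  ... | no x≢y = inj₂ (x≢y , fx≡fy , s x≢y)

  glued-isEquivalence : DecidableEquality A → IsEquivalence (Glued f S)
  glued-isEquivalence _≟ᴬ_ = record
    { refl  = inj₁ refl
    ; sym   = λ { (inj₁ x≡y) → inj₁ (sym x≡y)
                ; (inj₂ (x≢y , fx≡fy , s)) → inj₂ (≢-sym x≢y , sym fx≡fy , s) }
    ; trans = glued-trans
    }
    where
    glued-trans : ∀ {x y z} → Glued f S x y → Glued f S y z → Glued f S x z
    glued-trans (inj₁ refl) q = q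
    glued-trans p (inj₁ refl) = p
    glued-trans (inj₂ (_ , fx≡fy , s)) (inj₂ (_ , fy≡fz , _)) =
      glued-intro _≟ᴬ_ (trans fx≡fy fy≡fz) (const s)

module _ (G : FlowGraph) where
  open FlowGraph G

  φ⁻¹ : Pt (Fin n) → Fin n
  φ⁻¹ (vtx x) = x
  φ⁻¹ s⁺ = src
  φ⁻¹ t⁺ = entryHead
  φ⁻¹ s⁻ = exitTail
  φ⁻¹ t⁻ = tgt

  φ⁻¹-φ : ∀ j → φ⁻¹ (φ G j) ≡ j ⊎ (entryHead ≡ exitTail × j ≡ tgt × φ G j ≡ t⁺)
  φ⁻¹-φ j
    with j ≟ src | j ≟ entryHead | entryHead ≟ exitTail | j ≟ tgt
       | src ≟ exitTail | entryHead ≟ tgt | j ≟ exitTail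
  ... | yes p | _     | _     | _     | _     | _     | _     = inj₁ (sym p)
  ... | no _  | yes p | _     | _     | _     | _     | _     = inj₁ (sym p)
  ... | no _  | no _  | yes h | yes p | _     | _     | _     = inj₂ (h , p , refl)
  ... | no _  | no _  | yes _ | no _  | _     | _     | _     = inj₁ refl
  ... | no _  | no _  | no _  | _     | yes _ | yes _ | _     = inj₁ refl
  ... | no _  | no _  | no _  | _     | yes _ | no _  | yes p = inj₁ (sym p)
  ... | no _  | no _  | no _  | _     | no _  | _     | yes p = inj₁ (sym p)
  ... | no _  | no _  | no _  | yes p | yes _ | no _  | no _  = inj₁ (sym p)
  ... | no _  | no _  | no _  | yes p | no _  | _     | no _  = inj₁ (sym p)
  ... | no _  | no _  | no _  | no _  | yes _ | no _  | no _  = inj₁ refl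
  ... | no _  | no _  | no _  | no _  | no _  | _     | no _  = inj₁ refl

  φ-collision⇒StarHyp : ∀ {j l} → j ≢ l → φ G j ≡ φ G l → StarHyp G j
  φ-collision⇒StarHyp {j} {l} j≢l φj≡φl with φ⁻¹-φ j | φ⁻¹-φ l
  ... | inj₂ (h , j≡tgt , _) | _ = h , inj₂ j≡tgt
  ... | inj₁ j-fixed | inj₂ (h , _ , φl≡t⁺) =
    h , inj₁ (trans (sym j-fixed) (cong φ⁻¹ (trans φj≡φl φl≡t⁺)))
  ... | inj₁ j-fixed | inj₁ l-fixed =
    ⊥-elim (j≢l (trans (sym j-fixed) (trans (cong φ⁻¹ φj≡φl) l-fixed)))

module _ (G G' : FlowGraph) where

  private
    _∼_ = Sim G G'
    module Left  = IsEquivalence (glued-isEquivalence {f = φ G}  {S = Star G'} _≟_)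
    module Right = IsEquivalence (glued-isEquivalence {f = φ G'} {S = Star G}  _≟_)

  sim-sym : ∀ {x y} → x ∼ y → y ∼ x
  sim-sym {inj₁ _} {inj₁ _} = Left.sym
  sim-sym {inj₂ _} {inj₂ _} = Right.sym
  sim-sym {inj₁ _} {inj₂ _} p = p
  sim-sym {inj₂ _} {inj₁ _} p = p

  sim-trans : ∀ {x y z} → x ∼ y → y ∼ z → x ∼ z
  sim-trans {inj₁ _} {inj₁ _} {inj₁ _} = Left.trans
  sim-trans {inj₂ _} {inj₂ _} {inj₂ _} = Right.trans
  sim-trans {inj₁ _} {inj₁ _} {inj₂ _} (inj₁ refl) q = q
  sim-trans {inj₁ _} {inj₁ _} {inj₂ _} (inj₂ (_ , φj≡φk , s)) (e , _ , b) =
    trans (cong (mapPt inj₁) φj≡φk) e , const s , b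
  sim-trans {inj₂ _} {inj₂ _} {inj₁ _} (inj₁ refl) q = q
  sim-trans {inj₂ _} {inj₂ _} {inj₁ _} (inj₂ (_ , φj≡φk , s)) (e , a , _) =
    trans e (cong (mapPt inj₂) (sym φj≡φk)) , a , const s
  sim-trans {inj₁ _} {inj₂ _} {inj₂ _} p (inj₁ refl) = p
  sim-trans {inj₁ _} {inj₂ _} {inj₂ _} (e , a , _) (inj₂ (_ , φk≡φl , s)) =
    trans e (cong (mapPt inj₂) φk≡φl) , a , const s
  sim-trans {inj₂ _} {inj₁ _} {inj₁ _} p (inj₁ refl) = p
  sim-trans {inj₂ _} {inj₁ _} {inj₁ _} (e , _ , b) (inj₂ (_ , φk≡φl , s)) =
    trans (cong (mapPt inj₁) (sym φk≡φl)) e , const s , b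
  sim-trans {inj₁ j} {inj₂ _} {inj₁ _} (e₁ , a , _) (e₂ , _ , _) =
    glued-intro _≟_ φj≡φl (λ j≢l → a (φ-collision⇒StarHyp G j≢l φj≡φl))
    where φj≡φl = mapPt-injective (fromInj₁ (const j)) (λ _ → refl) (trans e₁ (sym e₂))
  sim-trans {inj₂ j'} {inj₁ _} {inj₂ _} (e₁ , _ , b) (e₂ , _ , _) =
    glued-intro _≟_ φj'≡φl' (λ j'≢l' → b (φ-collision⇒StarHyp G' j'≢l' φj'≡φl'))
    where φj'≡φl' = mapPt-injective (fromInj₂ (const j')) (λ _ → refl) (trans (sym e₁) e₂)

mainTheorem15 : (G G' : FlowGraph) → IsEquivalence (Sim G G')
mainTheorem15 G G' = record
  { refl  = λ { {inj₁ _} → inj₁ refl ; {inj₂ _} → inj₁ refl }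
  ; sym   = sim-sym G G'
  ; trans = sim-trans G G'
  }
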